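{- Let $\mathcal C$ be a cartesian closed category with an object $D$ and morphisms $\bar c_1,\dots,\bar c_n,\mathtt{fail}:1\to D$, $\mathtt{app}:D\to D^D$, $\mathtt{lam}:D^D\to D$, $\mathtt{case}:D^n\times D\to D$, and suppose $(\mathrm{id}_{D^n}\times\mathtt{fail});\mathtt{case}=\pi_2;\mathtt{fail}$ as maps $D^n\times1\to D$. Let $\mathtt{comp}=\langle(\mathrm{id}_{D^n}\times\pi^n_1);\mathtt{case},\dots,(\mathrm{id}_{D^n}\times\pi^n_n);\mathtt{case}\rangle:D^n\times D^n\to D^n$. Then for any case-bindings $\theta,\phi$ whose free variables are in $\Gamma=x_1,\dots,x_k$, $$\langle[\![\theta]\!]_\Gamma,[\![\phi]\!]_\Gamma\rangle;\mathtt{comp}=[\![\theta\circ\phi]\!]_\Gamma .$$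
   Context: Terms of the lambda calculus with constructors over constructors $\{c_1,\dots,c_n\}$: $t,u::=x\mid tu\mid\lambda x.t\mid c\mid\{\theta\}\cdot t$, with case-bindings $\theta=\{d_1\mapsto u_1;\dots;d_k\mapsto u_k\}$ ($k\ge0$, $d_j$ pairwise distinct constructors), $\mathrm{dom}(\theta)=\{d_1,\dots,d_k\}$; terms up to $\alpha$-conversion. Composition of case-bindings: $\theta\circ\{d_1\mapsto t_1;\dots;d_k\mapsto t_k\}=\{d_1\mapsto\{\theta\}\cdot t_1;\dots;d_k\mapsto\{\theta\}\cdot t_k\}$. Categorical notation: diagrammatic composition $f;g$ (first $f$); pairing $\langle f,g\rangle$; projections $\pi^k_i$ ($\pi_i=\pi^2_i$); $!_A:A\to 1$; $D^k$ $k$-fold product; $\mathrm{ev}$ evaluation; $\Lambda$ currying. Interpretation for $\Gamma=x_1,\dots,x_k$: $[\![x_i]\!]_\Gamma=\pi^k_i$; $[\![tu]\!]_\Gamma=\langle[\![t]\!]_\Gamma,[\![u]\!]_\Gamma\rangle;(\mathtt{app}\times\mathrm{id}_D);\mathrm{ev}$; $[\![\lambda x_{k+1}.t]\!]_\Gamma=\Lambda(f_t);\mathtt{lam}$ with $x_{k+1}\notin\Gamma$ and $f_t$ the iso $D^k\times D\cong D^{k+1}$ followed by $[\![t]\!]_{\Gamma,x_{k+1}}$; $[\![c_i]\!]_\Gamma=!_{D^k};\bar c_i$; $[\![\{\theta\}\cdot t]\!]_\Gamma=\langle[\![\theta]\!]_\Gamma,[\![t]\!]_\Gamma\rangle;\mathtt{case}$;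 for a case-binding, $[\![\theta]\!]_\Gamma=\langle f_1,\dots,f_n\rangle:D^k\to D^n$ with $f_i=[\![u_i]\!]_\Gamma$ if $(c_i\mapsto u_i)\in\theta$ and $f_i=!_{D^k};\mathtt{fail}$ if $c_i\notin\mathrm{dom}(\theta)$. -}

module Defs where

open import Level using (Level; _⊔_)
open import Data.Nat using (ℕ; zero; suc)
open import Data.Fin using (Fin; zero; suc)
open import Data.Maybe using (Maybe; just; nothing)
import Data.Maybe as Maybe
open import Relation.Binary.Structures using (IsEquivalence)

record CCC (o ℓ e : Level) : Set (Level.suc (o ⊔ ℓ ⊔ e)) where
  infixr 9 _⨾_
  infix  4 _≈_
  infixr 7 _×_
  infix  3 _⇒_
  infixr 8 _^_
  field
    Obj  : Set o
    _⇒_  : Obj → Obj → Set ℓ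
    _≈_  : ∀ {A B} → A ⇒ B → A ⇒ B → Set e
    ≈-equiv : ∀ {A B} → IsEquivalence (_≈_ {A} {B})
    id   : ∀ {A} → A ⇒ A
    _⨾_  : ∀ {A B C} → A ⇒ B → B ⇒ C → A ⇒ C
    ⨾-resp-≈ : ∀ {A B C} {f f′ : A ⇒ B} {g g′ : B ⇒ C} →
               f ≈ f′ → g ≈ g′ → f ⨾ g ≈ f′ ⨾ g′
    assoc : ∀ {A B C D} {f : A ⇒ B} {g : B ⇒ C} {h : C ⇒ D} →
            (f ⨾ g) ⨾ h ≈ f ⨾ (g ⨾ h)
    identityˡ : ∀ {A B} {f : A ⇒ B} → id ⨾ f ≈ f
    identityʳ : ∀ {A B} {f : A ⇒ B} → f ⨾ id ≈ f
    𝟙 : Obj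
    ! : ∀ {A} → A ⇒ 𝟙
    !-unique : ∀ {A} (f : A ⇒ 𝟙) → f ≈ !
    _×_ : Obj → Obj → Obj
    π₁  : ∀ {A B} → A × B ⇒ A
    π₂  : ∀ {A B} → A × B ⇒ B
    ⟨_,_⟩ : ∀ {X A B} → X ⇒ A → X ⇒ B → X ⇒ A × B
    project₁ : ∀ {X A B} {f : X ⇒ A} {g : X ⇒ B} → ⟨ f , g ⟩ ⨾ π₁ ≈ f
    project₂ : ∀ {X A B} {f : X ⇒ A} {g : X ⇒ B} → ⟨ f , g ⟩ ⨾ π₂ ≈ g
    ⟨⟩-unique : ∀ {X A B} {f : X ⇒ A} {g : X ⇒ B} {h : X ⇒ A × B} →
                h ⨾ π₁ ≈ f → h ⨾ π₂ ≈ g → h ≈ ⟨ f , g ⟩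
    _^_ : Obj → Obj → Obj
    ev  : ∀ {A B} → (B ^ A) × A ⇒ B
    Λ   : ∀ {C A B} → C × A ⇒ B → C ⇒ B ^ A

  infixr 8 _⁂_
  _⁂_ : ∀ {A B C D} → A ⇒ B → C ⇒ D → A × C ⇒ B × D
  f ⁂ g = ⟨ π₁ ⨾ f , π₂ ⨾ g ⟩

  field
    β : ∀ {C A B} {f : C × A ⇒ B} → (Λ f ⁂ id) ⨾ ev ≈ f
    Λ-unique : ∀ {C A B} {f : C × A ⇒ B} {g : C ⇒ B ^ A} →
               (g ⁂ id) ⨾ ev ≈ f → g ≈ Λ f

  infixr 8 _^^_
  _^^_ : Obj → ℕ → Obj
  A ^^ zero  = 𝟙
  A ^^ suc k = (A ^^ k) × A

  -- projections π^k_i  (index zero = last component)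
  proj : ∀ {A} {k} → Fin k → A ^^ k ⇒ A
  proj zero    = π₂
  proj (suc i) = π₁ ⨾ proj i

  tuple : ∀ {X A} {k} → (Fin k → X ⇒ A) → X ⇒ A ^^ k
  tuple {k = zero}  f = !
  tuple {k = suc k} f = ⟨ tuple (λ i → f (suc i)) , f zero ⟩

-- Lambda calculus with constructors c_0,…,c_{n-1} (constructors = Fin n),
-- terms with free variables among k variables (de Bruijn indices, so
-- terms are taken up to α-conversion).  A case-binding is a finite
-- partial map from constructors to terms: Fin n → Maybe (Term n k)
-- (domain = the i with a 'just'; distinctness of the d_j is automatic).

data Term (n : ℕ) (k : ℕ) : Set where
  var   : Fin k → Term n k
  _·_   : Term n k → Term n k → Term n k
  ƛ     : Term n (suc k) → Term n k
  con   : Fin n → Term n k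
  ⟪_⟫·_ : (Fin n → Maybe (Term n k)) → Term n k → Term n k

CaseBinding : ℕ → ℕ → Set
CaseBinding n k = Fin n → Maybe (Term n k)

infixr 9 _∘ᶜ_
_∘ᶜ_ : ∀ {n k} → CaseBinding n k → CaseBinding n k → CaseBinding n k
(θ ∘ᶜ φ) i = Maybe.map (⟪ θ ⟫·_) (φ i)

module Interpretation {o ℓ e} (𝒞 : CCC o ℓ e) (n : ℕ)
  (D : CCC.Obj 𝒞)
  (c̄ : Fin n → CCC._⇒_ 𝒞 (CCC.𝟙 𝒞) D)
  (fail : CCC._⇒_ 𝒞 (CCC.𝟙 𝒞) D)
  (app : CCC._⇒_ 𝒞 D (CCC._^_ 𝒞 D D))
  (lam : CCC._⇒_ 𝒞 (CCC._^_ 𝒞 D D) D)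
  (case : CCC._⇒_ 𝒞 (CCC._×_ 𝒞 (CCC._^^_ 𝒞 D n) D) D)
  where
  open CCC 𝒞

  mutual
    ⟦_⟧ : ∀ {k} → Term n k → D ^^ k ⇒ D
    ⟦ var i ⟧     = proj i
    ⟦ t · u ⟧     = ⟨ ⟦ t ⟧ , ⟦ u ⟧ ⟩ ⨾ (app ⁂ id) ⨾ ev
    ⟦ ƛ t ⟧       = Λ ⟦ t ⟧ ⨾ lam     -- D^k × D is literally D^(k+1)
    ⟦ con i ⟧     = ! ⨾ c̄ i
    ⟦ ⟪ θ ⟫· t ⟧  = ⟨ ⟦ θ ⟧ᵇ , ⟦ t ⟧ ⟩ ⨾ case

    ⟦_⟧ᵇ : ∀ {k} → CaseBinding n k → D ^^ k ⇒ D ^^ n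
    ⟦ θ ⟧ᵇ = tuple (λ i → ⟦ θ i ⟧ᵐ)

    ⟦_⟧ᵐ : ∀ {k} → Maybe (Term n k) → D ^^ k ⇒ D
    ⟦ nothing ⟧ᵐ = ! ⨾ fail
    ⟦ just u ⟧ᵐ  = ⟦ u ⟧

  comp : (D ^^ n) × (D ^^ n) ⇒ D ^^ n
  comp = tuple {k = n} (λ i → (id ⁂ proj {k = n} i) ⨾ case)

-- Both sides are maps into D^n, so it suffices to compare them after each
-- projection π_i.  Projecting ⟨⟦θ⟧,⟦φ⟧⟩;comp gives ⟨⟦θ⟧, ⟦φ⟧;π_i⟩;case.  If
-- c_i ↦ t is in φ this is ⟦{θ}·t⟧, the i-th component of ⟦θ∘φ⟧; if c_i is not
-- in dom(φ) it is ⟨⟦θ⟧, !;fail⟩;case, which strictness of case in fail turns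
-- into !;fail, matching c_i ∉ dom(θ∘φ).
module Submission where

open import Defs
open import Data.Nat using (ℕ)
open import Data.Fin using (Fin; zero; suc)
open import Data.Maybe using (Maybe; just; nothing)
import Data.Maybe as Maybe
open import Relation.Binary.Bundles using (Setoid)
import Relation.Binary.Reasoning.Setoid as SetoidReasoning

module CCC-Properties {o ℓ e} (𝒞 : CCC o ℓ e) where
  open CCC 𝒞

  hom-setoid : Obj → Obj → Setoid ℓ e
  hom-setoid A B = record { Carrier = A ⇒ B ; _≈_ = _≈_ ; isEquivalence = ≈-equiv }

  module HomReasoning {A B : Obj} = SetoidReasoning (hom-setoid A B)
  open HomReasoning public using (begin_; step-≈-⟩; step-≈-⟨; _∎)
  module ≈ {A B : Obj} = Setoid (hom-setoid A B)

  ⨾-congˡ : ∀ {A B C} {f : A ⇒ B} {g g′ : B ⇒ C} → g ≈ g′ → f ⨾ g ≈ f ⨾ g′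
  ⨾-congˡ = ⨾-resp-≈ ≈.refl

  ⨾-congʳ : ∀ {A B C} {f f′ : A ⇒ B} {g : B ⇒ C} → f ≈ f′ → f ⨾ g ≈ f′ ⨾ g
  ⨾-congʳ p = ⨾-resp-≈ p ≈.refl

  ⟨⟩-congˡ : ∀ {X A B} {f : X ⇒ A} {g g′ : X ⇒ B} → g ≈ g′ → ⟨ f , g ⟩ ≈ ⟨ f , g′ ⟩
  ⟨⟩-congˡ p = ⟨⟩-unique project₁ (≈.trans project₂ p)

  ⟨⟩⨾⁂ : ∀ {X A B C D} {f : X ⇒ A} {g : X ⇒ B} {a : A ⇒ C} {b : B ⇒ D} →
         ⟨ f , g ⟩ ⨾ (a ⁂ b) ≈ ⟨ f ⨾ a , g ⨾ b ⟩
  ⟨⟩⨾⁂ {f = f} {g} {a} {b} = ⟨⟩-unique first second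
    where
    first : (⟨ f , g ⟩ ⨾ (a ⁂ b)) ⨾ π₁ ≈ f ⨾ a
    first = begin
      (⟨ f , g ⟩ ⨾ (a ⁂ b)) ⨾ π₁  ≈⟨ assoc ⟩
      ⟨ f , g ⟩ ⨾ (a ⁂ b) ⨾ π₁    ≈⟨ ⨾-congˡ project₁ ⟩
      ⟨ f , g ⟩ ⨾ π₁ ⨾ a          ≈⟨ assoc ⟨
      (⟨ f , g ⟩ ⨾ π₁) ⨾ a        ≈⟨ ⨾-congʳ project₁ ⟩
      f ⨾ a                       ∎
    second : (⟨ f , g ⟩ ⨾ (a ⁂ b)) ⨾ π₂ ≈ g ⨾ b
    second = begin
      (⟨ f , g ⟩ ⨾ (a ⁂ b)) ⨾ π₂  ≈⟨ assoc ⟩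
      ⟨ f , g ⟩ ⨾ (a ⁂ b) ⨾ π₂    ≈⟨ ⨾-congˡ project₂ ⟩
      ⟨ f , g ⟩ ⨾ π₂ ⨾ b          ≈⟨ assoc ⟨
      (⟨ f , g ⟩ ⨾ π₂) ⨾ b        ≈⟨ ⨾-congʳ project₂ ⟩
      g ⨾ b                       ∎

  ⟨⟩⨾id⁂ : ∀ {X A B C} {f : X ⇒ A} {g : X ⇒ B} {b : B ⇒ C} →
           ⟨ f , g ⟩ ⨾ (id ⁂ b) ≈ ⟨ f , g ⨾ b ⟩
  ⟨⟩⨾id⁂ = ≈.trans ⟨⟩⨾⁂ (⟨⟩-unique (≈.trans project₁ identityʳ) project₂)

  tuple-proj : ∀ {X A k} (f : Fin k → X ⇒ A) (i : Fin k) → tuple f ⨾ proj i ≈ f i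
  tuple-proj f zero    = project₂
  tuple-proj f (suc i) = begin
    tuple f ⨾ π₁ ⨾ proj i             ≈⟨ assoc ⟨
    (tuple f ⨾ π₁) ⨾ proj i           ≈⟨ ⨾-congʳ project₁ ⟩
    tuple (λ j → f (suc j)) ⨾ proj i  ≈⟨ tuple-proj (λ j → f (suc j)) i ⟩
    f (suc i)                         ∎

  tuple-unique : ∀ {X A k} {f : Fin k → X ⇒ A} {h : X ⇒ A ^^ k} →
                 (∀ i → h ⨾ proj i ≈ f i) → h ≈ tuple f
  tuple-unique {k = ℕ.zero}  {h = h} _ = !-unique h
  tuple-unique {k = ℕ.suc k} p =
    ⟨⟩-unique (tuple-unique (λ i → ≈.trans assoc (p (suc i)))) (p zero)

module CaseComposition {o ℓ e} (𝒞 : CCC o ℓ e) where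
  open CCC 𝒞
  open CCC-Properties 𝒞

  module _ (n : ℕ) (D : Obj) (c̄ : Fin n → 𝟙 ⇒ D) (fail : 𝟙 ⇒ D)
           (app : D ⇒ D ^ D) (lam : D ^ D ⇒ D) (case : D ^^ n × D ⇒ D) where
    open Interpretation 𝒞 n D c̄ fail app lam case

    ⟨⟩⨾comp⨾proj : ∀ {X} {f g : X ⇒ D ^^ n} (i : Fin n) →
                   ⟨ f , g ⟩ ⨾ comp ⨾ proj i ≈ ⟨ f , g ⨾ proj i ⟩ ⨾ case
    ⟨⟩⨾comp⨾proj {f = f} {g} i = begin
      ⟨ f , g ⟩ ⨾ comp ⨾ proj i             ≈⟨ ⨾-congˡ (tuple-proj _ i) ⟩
      ⟨ f , g ⟩ ⨾ (id ⁂ proj i) ⨾ case      ≈⟨ assoc ⟨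
      (⟨ f , g ⟩ ⨾ (id ⁂ proj i)) ⨾ case    ≈⟨ ⨾-congʳ ⟨⟩⨾id⁂ ⟩
      ⟨ f , g ⨾ proj i ⟩ ⨾ case             ∎

    module _ (case-strict : (id ⁂ fail) ⨾ case ≈ π₂ ⨾ fail) where

      case-fail : ∀ {X} (h : X ⇒ D ^^ n) → ⟨ h , ! ⨾ fail ⟩ ⨾ case ≈ ! ⨾ fail
      case-fail h = begin
        ⟨ h , ! ⨾ fail ⟩ ⨾ case          ≈⟨ ⨾-congʳ ⟨⟩⨾id⁂ ⟨
        (⟨ h , ! ⟩ ⨾ (id ⁂ fail)) ⨾ case  ≈⟨ assoc ⟩
        ⟨ h , ! ⟩ ⨾ (id ⁂ fail) ⨾ case    ≈⟨ ⨾-congˡ case-strict ⟩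
        ⟨ h , ! ⟩ ⨾ π₂ ⨾ fail             ≈⟨ assoc ⟨
        (⟨ h , ! ⟩ ⨾ π₂) ⨾ fail           ≈⟨ ⨾-congʳ project₂ ⟩
        ! ⨾ fail                          ∎

      case-⟦⟧ᵐ : ∀ {k} (θ : CaseBinding n k) (m : Maybe (Term n k)) →
                 ⟨ ⟦ θ ⟧ᵇ , ⟦ m ⟧ᵐ ⟩ ⨾ case ≈ ⟦ Maybe.map (⟪ θ ⟫·_) m ⟧ᵐ
      case-⟦⟧ᵐ θ (just t) = ≈.refl
      case-⟦⟧ᵐ θ nothing  = case-fail ⟦ θ ⟧ᵇ

      ⟦∘ᶜ⟧ᵇ : ∀ {k} (θ φ : CaseBinding n k) → ⟨ ⟦ θ ⟧ᵇ , ⟦ φ ⟧ᵇ ⟩ ⨾ comp ≈ ⟦ θ ∘ᶜ φ ⟧ᵇ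
      ⟦∘ᶜ⟧ᵇ θ φ = tuple-unique λ i → begin
        (⟨ ⟦ θ ⟧ᵇ , ⟦ φ ⟧ᵇ ⟩ ⨾ comp) ⨾ proj i    ≈⟨ assoc ⟩
        ⟨ ⟦ θ ⟧ᵇ , ⟦ φ ⟧ᵇ ⟩ ⨾ comp ⨾ proj i      ≈⟨ ⟨⟩⨾comp⨾proj i ⟩
        ⟨ ⟦ θ ⟧ᵇ , ⟦ φ ⟧ᵇ ⨾ proj i ⟩ ⨾ case     ≈⟨ ⨾-congʳ (⟨⟩-congˡ (tuple-proj _ i)) ⟩
        ⟨ ⟦ θ ⟧ᵇ , ⟦ φ i ⟧ᵐ ⟩ ⨾ case            ≈⟨ case-⟦⟧ᵐ θ (φ i) ⟩
        ⟦ (θ ∘ᶜ φ) i ⟧ᵐ                         ∎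

lemma1 : ∀ {o ℓ e} (𝒞 : CCC o ℓ e) (n : ℕ) (D : CCC.Obj 𝒞)
           (c̄ : Fin n → CCC._⇒_ 𝒞 (CCC.𝟙 𝒞) D)
           (fail : CCC._⇒_ 𝒞 (CCC.𝟙 𝒞) D)
           (app : CCC._⇒_ 𝒞 D (CCC._^_ 𝒞 D D))
           (lam : CCC._⇒_ 𝒞 (CCC._^_ 𝒞 D D) D)
           (case : CCC._⇒_ 𝒞 (CCC._×_ 𝒞 (CCC._^^_ 𝒞 D n) D) D) →
           CCC._≈_ 𝒞 (CCC._⨾_ 𝒞 (CCC._⁂_ 𝒞 (CCC.id 𝒞) fail) case)
                     (CCC._⨾_ 𝒞 (CCC.π₂ 𝒞) fail) →
           ∀ (k : ℕ) (θ φ : CaseBinding n k) →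
           CCC._≈_ 𝒞
             (CCC._⨾_ 𝒞
               (CCC.⟨_,_⟩ 𝒞 (Interpretation.⟦_⟧ᵇ 𝒞 n D c̄ fail app lam case θ)
                            (Interpretation.⟦_⟧ᵇ 𝒞 n D c̄ fail app lam case φ))
               (Interpretation.comp 𝒞 n D c̄ fail app lam case))
             (Interpretation.⟦_⟧ᵇ 𝒞 n D c̄ fail app lam case (θ ∘ᶜ φ))
lemma1 𝒞 n D c̄ fail app lam case case-strict k =
  CaseComposition.⟦∘ᶜ⟧ᵇ 𝒞 n D c̄ fail app lam case case-strict
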